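{- For every integer $n\geq 2$, the Gutman index of the pentagonal cylinder chain $P_n$ is \[\operatorname{Gut}(P_n)=\begin{cases}49n^3+64n^2+5n, & n \text{ even},\\ 49n^3+64n^2+4n, & n \text{ odd}.\end{cases}\]
   Context: For $n\geq 2$, $P_n$ has vertex set $\{u_1,\dots,u_{2n}\}\cup\{u'_1,\dots,u'_{2n}\}\cup\{w_1,\dots,w_n\}$ and edges $u_ku_{k+1}$, $u'_ku'_{k+1}$ ($1\le k\le 2n-1$), $u_{2n}u_1$, $u'_{2n}u'_1$, $u_{2k-1}u'_{2k-1}$ ($1\le k\le n$), and $u_{2k}w_k$, $w_ku'_{2k}$ ($1\le k\le n$). For a connected graph with vertices $v_1,\dots,v_N$, degrees $d_i$ and shortest-path distances $d_{ij}$, the Gutman index is $\operatorname{Gut}(G)=\frac12\sum_{i=1}^N\sum_{j=1}^N d_id_jd_{ij}$. -}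

module Defs where

open import Data.Nat using (ℕ; zero; suc; _+_; _*_; _∸_; _≤_; _/_)
open import Data.Nat.Properties using () renaming (_≟_ to _≟ℕ_)
open import Data.Product using (_×_; _,_)
open import Data.Sum using (_⊎_)
open import Data.List using (List; []; _∷_; map; upTo; concat; length; filter; _++_)
open import Data.Nat.ListAction using (sum)
open import Relation.Binary.PropositionalEquality using (_≡_; refl; cong₂)
open import Relation.Binary using (DecidableEquality)
open import Relation.Nullary using (yes; no; Dec)
open import Data.Sum using (inj₁; inj₂)
open import Relation.Nullary.Decidable using (_⊎-dec_; _×-dec_)

-- Vertex labels: u_k ↦ (U , k), u'_k ↦ (U' , k), w_k ↦ (W , k)  (1-indexed as in the paper)
data Kind : Set where
  U U' W : Kind

_≟K_ : DecidableEquality Kind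
U  ≟K U  = yes refl
U  ≟K U' = no λ ()
U  ≟K W  = no λ ()
U' ≟K U  = no λ ()
U' ≟K U' = yes refl
U' ≟K W  = no λ ()
W  ≟K U  = no λ ()
W  ≟K U' = no λ ()
W  ≟K W  = yes refl

V : Set
V = Kind × ℕ

_≟V_ : DecidableEquality V
(k , i) ≟V (k' , j) with k ≟K k' | i ≟ℕ j
... | yes refl | yes refl = yes refl
... | no ¬p    | _        = no λ { refl → ¬p refl }
... | yes _    | no ¬q    = no λ { refl → ¬q refl }

oneTo : ℕ → List ℕ
oneTo m = map suc (upTo m)

vertices : ℕ → List V
vertices n = map (U ,_) (oneTo (2 * n)) ++ map (U' ,_) (oneTo (2 * n)) ++ map (W ,_) (oneTo n)

edges : ℕ → List (V × V)
edges n =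
     map (λ k → ((U , k) , (U , suc k))) (oneTo (2 * n ∸ 1))
  ++ map (λ k → ((U' , k) , (U' , suc k))) (oneTo (2 * n ∸ 1))
  ++ ((U , 2 * n) , (U , 1)) ∷ ((U' , 2 * n) , (U' , 1)) ∷ []
  ++ map (λ k → ((U , 2 * k ∸ 1) , (U' , 2 * k ∸ 1))) (oneTo n)
  ++ map (λ k → ((U , 2 * k) , (W , k))) (oneTo n)
  ++ map (λ k → ((W , k) , (U' , 2 * k))) (oneTo n)

_≟E_ : DecidableEquality (V × V)
(a , b) ≟E (c , d) with a ≟V c | b ≟V d
... | yes refl | yes refl = yes refl
... | no ¬p    | _        = no λ { refl → ¬p refl }
... | yes _    | no ¬q    = no λ { refl → ¬q refl }

open import Data.List.Membership.DecPropositional _≟E_ using (_∈_; _∈?_)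

Adj : ℕ → V → V → Set
Adj n a b = ((a , b) ∈ edges n) ⊎ ((b , a) ∈ edges n)

Adj? : ∀ n a b → Dec (Adj n a b)
Adj? n a b = ((a , b) ∈? edges n) ⊎-dec ((b , a) ∈? edges n)

deg : ℕ → V → ℕ
deg n a = length (filter (Adj? n a) (vertices n))

data Walk (n : ℕ) : V → V → ℕ → Set where
  here : ∀ {a} → Walk n a a 0
  step : ∀ {a b c k} → Adj n a b → Walk n b c k → Walk n a c (suc k)

IsDist : ℕ → V → V → ℕ → Set
IsDist n a b d = Walk n a b d × (∀ k → Walk n a b k → d ≤ k)

gutSum : ℕ → (V → V → ℕ) → ℕ
gutSum n dist = sum (map (λ a → sum (map (λ b → deg n a * deg n b * dist a b) (vertices n))) (vertices n))

Gut : ℕ → (V → V → ℕ) → ℕ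
Gut n dist = gutSum n dist / 2

{-# OPTIONS --safe #-}
module Submission where

-- The distance in P_n has a closed form δ in terms of the distance cyc on the 2n-cycle:
-- cyc i j between u_i, u_j (or u'_i, u'_j), 1 + cyc i (2k) between u_i (or u'_i) and w_k,
-- 2 + cyc (2k) (2l) between w_k ≠ w_l, and 1 + cyc i j between u_i and u'_j, except that
-- it is 2 when i = j is even.  No walk is shorter than δ because δ changes by at most one
-- along every edge, and an explicit walk of length δ exists.  The degrees are 3, 3, 2 and
-- each row of cyc sums to ⌊m²/4⌋ on an m-cycle, so summing the nine blocks of the Gutman
-- sum gives 2 Gut(P_n) = 96n³ + 128n² + 10n + 8n⌊n²/4⌋.

open import Defs
open import Data.Bool using (Bool; true; false; not; _∧_; if_then_else_)
open import Data.Bool.Properties using (not-¬)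
open import Data.Empty using (⊥-elim)
open import Data.List using (List; []; _∷_; map; upTo; applyUpTo; _++_; filter; length)
open import Data.List.Membership.Propositional using (_∈_)
open import Data.List.Membership.Propositional.Properties using (∈-map⁺; ∈-map⁻; ∈-++⁻; ∈-++⁺ˡ; ∈-++⁺ʳ; ∈-upTo⁺; ∈-upTo⁻)
open import Data.List.Properties using (map-++; map-∘; map-cong-local; map-applyUpTo)
import Data.List.Relation.Unary.All as All
open import Data.List.Relation.Unary.Any using (here; there)
open import Data.Nat
open import Data.Nat.DivMod using (m≡m%n+[m/n]*n; m*n/n≡m)
open import Data.Nat.ListAction using (sum)
open import Data.Nat.ListAction.Properties using (sum-++)
open import Data.Nat.Properties
open import Data.Nat.Tactic.RingSolver using (solve-∀)
open import Data.Product using (_×_; _,_; ∃; proj₁; proj₂)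
open import Data.Sum using (_⊎_; inj₁; inj₂)
open import Function using (_∘_)
open import Relation.Binary using (tri<; tri≈; tri>)
open import Relation.Binary.PropositionalEquality
open import Relation.Nullary using (yes; no; ¬_; does)
open import Relation.Nullary.Decidable using (dec-true; dec-false)
open import Relation.Unary using (Decidable)

-- Finite sums

infix 4 _∈[1,_]
_∈[1,_] : ℕ → ℕ → Set
i ∈[1, m ] = 1 ≤ i × i ≤ m

∑ : (ℕ → ℕ) → ℕ → ℕ → ℕ
∑ f a zero    = 0
∑ f a (suc l) = f a + ∑ f (suc a) l

∑-cong-< : ∀ {f g} a l → (∀ x → a ≤ x → x < a + l → f x ≡ g x) → ∑ f a l ≡ ∑ g a l
∑-cong-< a zero    f≡g = refl
∑-cong-< a (suc l) f≡g = cong₂ _+_ (f≡g a ≤-refl (m<m+n a z<s))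
  (∑-cong-< (suc a) l λ x a<x x<a+l → f≡g x (<⇒≤ a<x) (subst (x <_) (sym (+-suc a l)) x<a+l))

∑-cong : ∀ {f g} a l → (∀ x → f x ≡ g x) → ∑ f a l ≡ ∑ g a l
∑-cong a l f≡g = ∑-cong-< a l (λ x _ _ → f≡g x)

∑₁-cong : ∀ {f g} M → (∀ {i} → i ∈[1, M ] → f i ≡ g i) → ∑ f 1 M ≡ ∑ g 1 M
∑₁-cong M f≡g = ∑-cong-< 1 M (λ i 1≤i i<1+M → f≡g (1≤i , s≤s⁻¹ i<1+M))

∑-suc : ∀ f a l → ∑ f (suc a) l ≡ ∑ (f ∘ suc) a l
∑-suc f a zero    = refl
∑-suc f a (suc l) = cong (f (suc a) +_) (∑-suc f (suc a) l)

∑-shift : ∀ f b a l → ∑ f (b + a) l ≡ ∑ (λ x → f (b + x)) a l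
∑-shift f b a zero    = refl
∑-shift f b a (suc l) = cong (f (b + a) +_) (begin
  ∑ f (suc (b + a)) l   ≡⟨ cong (λ z → ∑ f z l) (sym (+-suc b a)) ⟩
  ∑ f (b + suc a) l     ≡⟨ ∑-shift f b (suc a) l ⟩
  ∑ (λ x → f (b + x)) (suc a) l ∎)
  where open ≡-Reasoning

∑-shift₀ : ∀ f b l → ∑ f b l ≡ ∑ (λ x → f (b + x)) 0 l
∑-shift₀ f b l = trans (cong (λ z → ∑ f z l) (sym (+-identityʳ b))) (∑-shift f b 0 l)

∑-++ : ∀ f a l₁ l₂ → ∑ f a (l₁ + l₂) ≡ ∑ f a l₁ + ∑ f (a + l₁) l₂
∑-++ f a zero     l₂ = cong (λ z → ∑ f z l₂) (sym (+-identityʳ a))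
∑-++ f a (suc l₁) l₂ = begin
  f a + ∑ f (suc a) (l₁ + l₂)                   ≡⟨ cong (f a +_) (∑-++ f (suc a) l₁ l₂) ⟩
  f a + (∑ f (suc a) l₁ + ∑ f (suc a + l₁) l₂)
    ≡⟨ cong (λ z → f a + (∑ f (suc a) l₁ + ∑ f z l₂)) (sym (+-suc a l₁)) ⟩
  f a + (∑ f (suc a) l₁ + ∑ f (a + suc l₁) l₂)  ≡⟨ sym (+-assoc (f a) _ _) ⟩
  f a + ∑ f (suc a) l₁ + ∑ f (a + suc l₁) l₂    ∎
  where open ≡-Reasoning

∑-last : ∀ f a l → ∑ f a (suc l) ≡ ∑ f a l + f (a + l)
∑-last f a l = trans (cong (∑ f a) (+-comm 1 l)) (trans (∑-++ f a l 1) (cong (∑ f a l +_) (+-identityʳ _)))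

∑-distrib-+ : ∀ f g a l → ∑ (λ x → f x + g x) a l ≡ ∑ f a l + ∑ g a l
∑-distrib-+ f g a zero    = refl
∑-distrib-+ f g a (suc l) rewrite ∑-distrib-+ f g (suc a) l = interchange (f a) (g a) _ _
  where
  interchange : ∀ w x y z → (w + x) + (y + z) ≡ (w + y) + (x + z)
  interchange = solve-∀

∑-*ˡ : ∀ k f a l → ∑ (λ x → k * f x) a l ≡ k * ∑ f a l
∑-*ˡ k f a zero    = sym (*-zeroʳ k)
∑-*ˡ k f a (suc l) rewrite ∑-*ˡ k f (suc a) l = sym (*-distribˡ-+ k (f a) _)

∑-const : ∀ k a l → ∑ (λ _ → k) a l ≡ l * k
∑-const k a zero    = refl
∑-const k a (suc l) = cong (k +_) (∑-const k (suc a) l)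

∑-1+ : ∀ f a l → ∑ (λ x → suc (f x)) a l ≡ l + ∑ f a l
∑-1+ f a l = trans (∑-distrib-+ (λ _ → 1) f a l) (cong (_+ ∑ f a l) (trans (∑-const 1 a l) (*-identityʳ l)))

∑-zero : ∀ f a l → (∀ x → a ≤ x → x < a + l → f x ≡ 0) → ∑ f a l ≡ 0
∑-zero f a l f≡0 = trans (∑-cong-< a l f≡0) (trans (∑-const 0 a l) (*-zeroʳ l))

∑-swap : ∀ (f : ℕ → ℕ → ℕ) a l b k →
         ∑ (λ x → ∑ (f x) b k) a l ≡ ∑ (λ y → ∑ (λ x → f x y) a l) b k
∑-swap f a zero    b k = sym (∑-zero _ b k (λ _ _ _ → refl))
∑-swap f a (suc l) b k = trans (cong (∑ (f a) b k +_) (∑-swap f (suc a) l b k))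
  (sym (∑-distrib-+ (f a) (λ y → ∑ (λ x → f x y) (suc a) l) b k))

𝟙 : Bool → ℕ
𝟙 true  = 1
𝟙 false = 0

≡ᵇ-refl : ∀ x → (x ≡ᵇ x) ≡ true
≡ᵇ-refl x = dec-true (x ≟ x) refl

≢⇒≡ᵇ-false : ∀ {x y} → x ≢ y → (x ≡ᵇ y) ≡ false
≢⇒≡ᵇ-false {x} {y} = dec-false (x ≟ y)

∑-𝟙-≡ : ∀ {x M} → x ∈[1, M ] → ∑ (λ j → 𝟙 (j ≡ᵇ x)) 1 M ≡ 1
∑-𝟙-≡ {x} {M} (1≤x , x≤M) = go 1 M 1≤x (s≤s x≤M)
  where
  go : ∀ a l → a ≤ x → x < a + l → ∑ (λ j → 𝟙 (j ≡ᵇ x)) a l ≡ 1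
  go a zero    a≤x x<a = ⊥-elim (<-irrefl refl (≤-trans x<a (subst (_≤ x) (sym (+-identityʳ a)) a≤x)))
  go a (suc l) a≤x x<a+l with a ≟ x
  ... | yes refl rewrite ≡ᵇ-refl a =
    cong suc (∑-zero _ (suc a) l λ y a<y _ → cong 𝟙 (≢⇒≡ᵇ-false (>⇒≢ a<y)))
  ... | no a≢x rewrite ≢⇒≡ᵇ-false a≢x = go (suc a) l (≤∧≢⇒< a≤x a≢x) (subst (x <_) (+-suc a l) x<a+l)

-- Distance on a cycle

next : ℕ → ℕ → ℕ
next m i with i <? m
... | yes _ = suc i
... | no  _ = 1

steps : ℕ → ℕ → ℕ → ℕ
steps m i j with i ≤? j
... | yes _ = j ∸ i
... | no  _ = m + j ∸ i

cyc : ℕ → ℕ → ℕ → ℕ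
cyc m i j = steps m i j ⊓ steps m j i

next-< : ∀ {m i} → i < m → next m i ≡ suc i
next-< {m} {i} i<m with i <? m
... | yes _   = refl
... | no  i≮m = ⊥-elim (i≮m i<m)

next-last : ∀ m → next m m ≡ 1
next-last m with m <? m
... | yes m<m = ⊥-elim (<-irrefl refl m<m)
... | no  _   = refl

next-range : ∀ {m i} → i ∈[1, m ] → next m i ∈[1, m ]
next-range {m} {i} (1≤i , i≤m) with m≤n⇒m<n∨m≡n i≤m
... | inj₁ i<m  rewrite next-< i<m = z<s , i<m
... | inj₂ refl rewrite next-last i = ≤-refl , 1≤i

steps-≤ : ∀ m {i j} → i ≤ j → steps m i j ≡ j ∸ i
steps-≤ m {i} {j} i≤j with i ≤? j
... | yes _   = refl
... | no  i≰j = ⊥-elim (i≰j i≤j)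

steps-> : ∀ m {i j} → j < i → steps m i j ≡ m + j ∸ i
steps-> m {i} {j} j<i with i ≤? j
... | yes i≤j = ⊥-elim (<⇒≱ j<i i≤j)
... | no  _   = refl

steps-refl : ∀ m i → steps m i i ≡ 0
steps-refl m i = trans (steps-≤ m (≤-refl {i})) (n∸n≡0 i)

cyc-refl : ∀ m i → cyc m i i ≡ 0
cyc-refl m i rewrite steps-refl m i = refl

cyc-sym : ∀ m i j → cyc m i j ≡ cyc m j i
cyc-sym m i j = ⊓-comm (steps m i j) (steps m j i)

steps-next-source : ∀ {m i j} → i ∈[1, m ] → j ∈[1, m ] → i ≢ j →
                    steps m i j ≡ suc (steps m (next m i) j)
steps-next-source {m} {i} {j} (_ , i≤m) _ i≢j with m≤n⇒m<n∨m≡n i≤m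
... | inj₁ i<m rewrite next-< i<m with ≤-<-connex i j
...   | inj₁ i≤j = let i<j = ≤∧≢⇒< i≤j i≢j in
  trans (steps-≤ m i≤j) (trans (+-∸-assoc 1 i<j) (cong suc (sym (steps-≤ m i<j))))
...   | inj₂ j<i = trans (steps-> m j<i)
  (trans (+-∸-assoc 1 (≤-trans i<m (m≤m+n m j))) (cong suc (sym (steps-> m (m<n⇒m<1+n j<i)))))
steps-next-source {m} {.m} {suc j} _ (_ , j<m) m≢j | inj₂ refl rewrite next-last m =
  trans (steps-> m (≤∧≢⇒< j<m (m≢j ∘ sym))) (trans (m+n∸m≡n m (suc j)) (cong suc (sym (steps-≤ m z<s))))

steps-next-target : ∀ {m i j} → i ∈[1, m ] → j ∈[1, m ] → next m i ≢ j →
                    steps m j (next m i) ≡ suc (steps m j i)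
steps-next-target {m} {i} {j} (_ , i≤m) (_ , j≤m) next≢j with m≤n⇒m<n∨m≡n i≤m
... | inj₁ i<m rewrite next-< i<m with ≤-<-connex j i
...   | inj₁ j≤i =
  trans (steps-≤ m (m≤n⇒m≤1+n j≤i)) (trans (+-∸-assoc 1 j≤i) (cong suc (sym (steps-≤ m j≤i))))
...   | inj₂ i<j = trans (steps-> m (≤∧≢⇒< i<j next≢j)) (trans (cong (_∸ j) (+-suc m i))
  (trans (+-∸-assoc 1 (≤-trans j≤m (m≤m+n m i))) (cong suc (sym (steps-> m i<j)))))
steps-next-target {m} {.m} {j} _ (1≤j , j≤m) 1≢j | inj₂ refl rewrite next-last m =
  trans (steps-> m (≤∧≢⇒< 1≤j 1≢j)) (trans (cong (_∸ j) (+-comm m 1))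
    (trans (+-∸-assoc 1 j≤m) (cong suc (sym (steps-≤ m j≤m)))))

steps-next : ∀ {m i} → 2 ≤ m → i ∈[1, m ] → steps m i (next m i) ≡ 1
steps-next {m} {i} 2≤m (_ , i≤m) with m≤n⇒m<n∨m≡n i≤m
... | inj₁ i<m  rewrite next-< i<m =
  trans (steps-≤ m (n≤1+n i)) (trans (+-∸-assoc 1 (≤-refl {i})) (cong suc (n∸n≡0 i)))
... | inj₂ refl rewrite next-last i = trans (steps-> i 2≤m) (m+n∸m≡n i 1)

cyc-next : ∀ {m i j} → 2 ≤ m → i ∈[1, m ] → j ∈[1, m ] →
           cyc m i j ≤ suc (cyc m (next m i) j) × cyc m (next m i) j ≤ suc (cyc m i j)
cyc-next {m} {i} {j} 2≤m i∈ j∈ with i ≟ j | next m i ≟ j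
... | yes refl | _ rewrite cyc-refl m i =
  z≤n , m≤n⇒o⊓m≤n (steps m (next m i) i) (≤-reflexive (steps-next 2≤m i∈))
... | no _ | yes refl rewrite cyc-refl m (next m i) =
  m≤n⇒m⊓o≤n (steps m (next m i) i) (≤-reflexive (steps-next 2≤m i∈)) , z≤n
... | no i≢j | no next≢j
  rewrite steps-next-source i∈ j∈ i≢j | steps-next-target i∈ j∈ next≢j =
  ⊓-mono-≤ (≤-refl {suc a}) (m≤n⇒m≤1+n (n≤1+n b)) , ⊓-mono-≤ (m≤n⇒m≤1+n (n≤1+n a)) (≤-refl {suc b})
  where
  a = steps m (next m i) j
  b = steps m j i

arc : ℕ → ℕ → ℕ
arc m t = t ⊓ (m ∸ t)

arcSum : ℕ → ℕ
arcSum m = ∑ (arc m) 0 m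

steps-flip : ∀ m {i j} → i < j → steps m j i ≡ m ∸ steps m i j
steps-flip m {i} {j} i<j = begin
  steps m j i           ≡⟨ steps-> m i<j ⟩
  m + i ∸ j             ≡⟨ cong (λ z → m + i ∸ z) (sym (m+[n∸m]≡n (<⇒≤ i<j))) ⟩
  m + i ∸ (i + (j ∸ i)) ≡⟨ cong (_∸ (i + (j ∸ i))) (+-comm m i) ⟩
  i + m ∸ (i + (j ∸ i)) ≡⟨ [m+n]∸[m+o]≡n∸o i m (j ∸ i) ⟩
  m ∸ (j ∸ i)           ≡⟨ cong (m ∸_) (sym (steps-≤ m (<⇒≤ i<j))) ⟩
  m ∸ steps m i j       ∎
  where open ≡-Reasoning

cyc≡arc-steps : ∀ {m i} j → i ≤ m → cyc m i j ≡ arc m (steps m i j)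
cyc≡arc-steps {m} {i} j i≤m with <-cmp i j
... | tri≈ _ refl _ rewrite steps-refl m i = refl
... | tri< i<j _ _ rewrite steps-flip m i<j = refl
... | tri> _ _ j<i rewrite steps-flip m j<i =
  cong ((m ∸ s) ⊓_) (sym (m∸[m∸n]≡n s≤m))
  where
  s = steps m j i
  s≤m : s ≤ m
  s≤m = subst (_≤ m) (sym (steps-≤ m (<⇒≤ j<i))) (≤-trans (m∸n≤m i j) i≤m)

-- As j runs through 1, …, m, steps m i j runs through m + 1 − i, …, m − 1 and then 0, …, m − i.
∑-cyc : ∀ {m i} → i ∈[1, m ] → ∑ (cyc m i) 1 m ≡ arcSum m
∑-cyc {m} {suc p} (_ , i≤m) = begin
  ∑ (cyc m i) 1 m                ≡⟨ ∑-cong 1 m (λ j → cyc≡arc-steps j i≤m) ⟩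
  ∑ A 1 m                        ≡⟨ cong (∑ A 1) (trans (sym q+p≡m) (+-comm q p)) ⟩
  ∑ A 1 (p + q)                  ≡⟨ ∑-++ A 1 p q ⟩
  ∑ A 1 p + ∑ A i q              ≡⟨ cong₂ _+_ wrapped unwrapped ⟩
  ∑ (arc m) q p + ∑ (arc m) 0 q  ≡⟨ +-comm _ (∑ (arc m) 0 q) ⟩
  ∑ (arc m) 0 q + ∑ (arc m) q p  ≡⟨ sym (∑-++ (arc m) 0 q p) ⟩
  ∑ (arc m) 0 (q + p)            ≡⟨ cong (∑ (arc m) 0) q+p≡m ⟩
  arcSum m                       ∎
  where
  open ≡-Reasoning
  i = suc p
  q = suc (m ∸ i)
  A : ℕ → ℕ
  A j = arc m (steps m i j)
  q+p≡m : q + p ≡ m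
  q+p≡m = trans (sym (+-suc (m ∸ i) p)) (m∸n+n≡m i≤m)
  wrapped : ∑ A 1 p ≡ ∑ (arc m) q p
  wrapped = trans (∑-shift₀ A 1 p) (trans
    (∑-cong-< 0 p λ x _ x<p → cong (arc m)
      (trans (steps-> m (s≤s x<p)) (trans (+-∸-comm (suc x) i≤m) (+-suc (m ∸ i) x))))
    (sym (∑-shift₀ (arc m) q p)))
  unwrapped : ∑ A i q ≡ ∑ (arc m) 0 q
  unwrapped = trans (∑-shift₀ A i q)
    (∑-cong 0 q λ x → cong (arc m) (trans (steps-≤ m (m≤m+n i x)) (m+n∸m≡n i x)))

arc-lower : ∀ {m} t → t + t ≤ m → arc m t ≡ t
arc-lower {m} t 2t≤m = m≤n⇒m⊓n≡m (subst (_≤ m ∸ t) (m+n∸n≡m t t) (∸-monoˡ-≤ t 2t≤m))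

arc-upper : ∀ {a r} x → r ≤ a → arc (a + r) (a + x) ≡ r ∸ x
arc-upper {a} {r} x r≤a = trans (cong ((a + x) ⊓_) ([m+n]∸[m+o]≡n∸o a r x))
  (m≥n⇒m⊓n≡n (≤-trans (m∸n≤m r x) (≤-trans r≤a (m≤m+n a x))))

∑-id+∑-∸ : ∀ r → ∑ (λ x → x) 0 r + ∑ (r ∸_) 0 r ≡ r * r
∑-id+∑-∸ r = trans (sym (∑-distrib-+ (λ x → x) (r ∸_) 0 r))
  (trans (∑-cong-< 0 r (λ x _ x<r → m+[n∸m]≡n (<⇒≤ x<r))) (∑-const r 0 r))

arcSum-even : ∀ r → arcSum (r + r) ≡ r * r
arcSum-even r = begin
  ∑ (arc (r + r)) 0 (r + r)                        ≡⟨ ∑-++ (arc (r + r)) 0 r r ⟩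
  ∑ (arc (r + r)) 0 r + ∑ (arc (r + r)) r r        ≡⟨ cong₂ _+_ lower upper ⟩
  ∑ (λ x → x) 0 r + ∑ (r ∸_) 0 r                   ≡⟨ ∑-id+∑-∸ r ⟩
  r * r                                            ∎
  where
  open ≡-Reasoning
  lower : ∑ (arc (r + r)) 0 r ≡ ∑ (λ x → x) 0 r
  lower = ∑-cong-< 0 r λ t _ t<r → arc-lower t (+-mono-≤ (<⇒≤ t<r) (<⇒≤ t<r))
  upper : ∑ (arc (r + r)) r r ≡ ∑ (r ∸_) 0 r
  upper = trans (∑-shift₀ (arc (r + r)) r r) (∑-cong 0 r λ x → arc-upper x ≤-refl)

arcSum-odd : ∀ r → arcSum (suc (r + r)) ≡ r * suc r
arcSum-odd r = begin
  ∑ (arc m) 0 (suc r + r)                          ≡⟨ ∑-++ (arc m) 0 (suc r) r ⟩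
  ∑ (arc m) 0 (suc r) + ∑ (arc m) (suc r) r        ≡⟨ cong₂ _+_ lower upper ⟩
  (∑ (λ x → x) 0 r + r) + ∑ (r ∸_) 0 r             ≡⟨ cong (_+ ∑ (r ∸_) 0 r) (+-comm _ r) ⟩
  (r + ∑ (λ x → x) 0 r) + ∑ (r ∸_) 0 r             ≡⟨ +-assoc r _ _ ⟩
  r + (∑ (λ x → x) 0 r + ∑ (r ∸_) 0 r)             ≡⟨ cong (r +_) (∑-id+∑-∸ r) ⟩
  r + r * r                                        ≡⟨ sym (*-suc r r) ⟩
  r * suc r                                        ∎
  where
  open ≡-Reasoning
  m = suc r + r
  lower : ∑ (arc m) 0 (suc r) ≡ ∑ (λ x → x) 0 r + r
  lower = trans
    (∑-cong-< 0 (suc r) λ t _ t≤r → arc-lower t (m≤n⇒m≤1+n (+-mono-≤ (s≤s⁻¹ t≤r) (s≤s⁻¹ t≤r))))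
    (∑-last (λ x → x) 0 r)
  upper : ∑ (arc m) (suc r) r ≡ ∑ (r ∸_) 0 r
  upper = trans (∑-shift₀ (arc m) (suc r) r) (∑-cong 0 r λ x → arc-upper x (n≤1+n r))

cyc-double : ∀ m i j → cyc (2 * m) (2 * i) (2 * j) ≡ 2 * cyc m i j
cyc-double m i j = trans (cong₂ _⊓_ (steps-double i j) (steps-double j i))
  (sym (*-distribˡ-⊓ 2 (steps m i j) (steps m j i)))
  where
  steps-double : ∀ i j → steps (2 * m) (2 * i) (2 * j) ≡ 2 * steps m i j
  steps-double i j with ≤-<-connex i j
  ... | inj₁ i≤j = trans (steps-≤ (2 * m) (*-monoʳ-≤ 2 i≤j))
    (trans (sym (*-distribˡ-∸ 2 j i)) (cong (2 *_) (sym (steps-≤ m i≤j))))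
  ... | inj₂ j<i = trans (steps-> (2 * m) (*-monoʳ-< 2 j<i))
    (trans (cong (_∸ (2 * i)) (sym (*-distribˡ-+ 2 m j)))
    (trans (sym (*-distribˡ-∸ 2 (m + j) i)) (cong (2 *_) (sym (steps-> m j<i)))))

even : ℕ → Bool
even zero          = true
even (suc zero)    = false
even (suc (suc i)) = even i

even-suc : ∀ i → even (suc i) ≡ not (even i)
even-suc zero          = refl
even-suc (suc zero)    = refl
even-suc (suc (suc i)) = even-suc i

even-double : ∀ k → even (k + k) ≡ true
even-double zero    = refl
even-double (suc k) rewrite +-suc k k = even-double k

even-suc-double : ∀ k → even (suc (k + k)) ≡ false
even-suc-double zero    = refl
even-suc-double (suc k) rewrite +-suc k k = even-suc-double k

2*-double : ∀ k → 2 * k ≡ k + k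
2*-double k = cong (k +_) (+-identityʳ k)

even-or-odd : ∀ i → even i ≡ true ⊎ even i ≡ false
even-or-odd i with even i
... | true  = inj₁ refl
... | false = inj₂ refl

even⇒double : ∀ i → even i ≡ true → ∃ λ k → i ≡ 2 * k
even⇒double zero          _ = 0 , refl
even⇒double (suc (suc i)) e with even⇒double i e
... | k , refl = suc k , cong suc (sym (+-suc k (k + 0)))

odd⇒double : ∀ i → even i ≡ false → ∃ λ k → i ≡ suc (k + k)
odd⇒double (suc zero)    _ = 0 , refl
odd⇒double (suc (suc i)) e with odd⇒double i e
... | k , refl = suc k , cong (suc ∘ suc) (sym (+-suc k k))

even-2* : ∀ k → even (2 * k) ≡ true
even-2* k = trans (cong even (2*-double k)) (even-double k)

odd≢2* : ∀ {i} k → even i ≡ false → i ≢ 2 * k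
odd≢2* k odd refl = not-¬ (even-2* k) odd

∑-even : ∀ n → ∑ (𝟙 ∘ even) 1 (2 * n) ≡ n
∑-even n rewrite 2*-double n = go 0 n
  where
  go : ∀ a n → ∑ (𝟙 ∘ even) (suc (a + a)) (n + n) ≡ n
  go a zero    = refl
  go a (suc n) rewrite +-suc n n | even-suc-double a | even-double a =
    cong suc (trans (cong (λ z → ∑ (𝟙 ∘ even) (suc z) (n + n)) (sym (+-suc (suc a) a))) (go (suc a) n))

oneTo⁻ : ∀ {k M} → k ∈ oneTo M → k ∈[1, M ]
oneTo⁻ p with ∈-map⁻ suc p
... | _ , x∈ , refl = z<s , ∈-upTo⁻ x∈

oneTo⁺ : ∀ {k M} → k ∈[1, M ] → k ∈ oneTo M
oneTo⁺ {suc k} (_ , k<M) = ∈-map⁺ suc (∈-upTo⁺ k<M)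

length-filter≡sum : ∀ {A : Set} {P : A → Set} (P? : Decidable P) xs →
                    length (filter P? xs) ≡ sum (map (𝟙 ∘ does ∘ P?) xs)
length-filter≡sum P? []       = refl
length-filter≡sum P? (x ∷ xs) with does (P? x)
... | true  = cong suc (length-filter≡sum P? xs)
... | false = length-filter≡sum P? xs

sum-map-++ : ∀ {A : Set} (f : A → ℕ) xs ys → sum (map f (xs ++ ys)) ≡ sum (map f xs) + sum (map f ys)
sum-map-++ f xs ys = trans (cong sum (map-++ f xs ys)) (sum-++ (map f xs) (map f ys))

sum-applyUpTo : ∀ g M → sum (applyUpTo g M) ≡ ∑ g 0 M
sum-applyUpTo g zero    = refl
sum-applyUpTo g (suc M) = cong (g 0 +_) (trans (sum-applyUpTo (g ∘ suc) M) (sym (∑-suc g 0 M)))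

sum-map-oneTo : ∀ f M → sum (map f (oneTo M)) ≡ ∑ f 1 M
sum-map-oneTo f M = begin
  sum (map f (map suc (upTo M)))  ≡⟨ cong (sum ∘ map f) (map-applyUpTo (λ x → x) suc M) ⟩
  sum (map f (applyUpTo suc M))   ≡⟨ cong sum (map-applyUpTo suc f M) ⟩
  sum (applyUpTo (f ∘ suc) M)     ≡⟨ sum-applyUpTo (f ∘ suc) M ⟩
  ∑ (f ∘ suc) 0 M                 ≡⟨ ∑-suc f 0 M ⟨
  ∑ f 1 M                         ∎
  where open ≡-Reasoning

sum-vertices : ∀ n (f : V → ℕ) → sum (map f (vertices n)) ≡
               ∑ (f ∘ (U ,_)) 1 (2 * n) + (∑ (f ∘ (U' ,_)) 1 (2 * n) + ∑ (f ∘ (W ,_)) 1 n)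
sum-vertices n f = begin
  sum (map f (vertices n))
    ≡⟨ sum-map-++ f (map (U ,_) (oneTo (2 * n))) _ ⟩
  sum (map f (map (U ,_) (oneTo (2 * n)))) + sum (map f (map (U' ,_) (oneTo (2 * n)) ++ map (W ,_) (oneTo n)))
    ≡⟨ cong (sum (map f (map (U ,_) (oneTo (2 * n)))) +_) (sum-map-++ f (map (U' ,_) (oneTo (2 * n))) _) ⟩
  block U (2 * n) + (block U' (2 * n) + block W n)
    ≡⟨ cong₂ _+_ (∑-block U (2 * n)) (cong₂ _+_ (∑-block U' (2 * n)) (∑-block W n)) ⟩
  ∑ (f ∘ (U ,_)) 1 (2 * n) + (∑ (f ∘ (U' ,_)) 1 (2 * n) + ∑ (f ∘ (W ,_)) 1 n) ∎
  where
  open ≡-Reasoning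
  block : Kind → ℕ → ℕ
  block K M = sum (map f (map (K ,_) (oneTo M)))
  ∑-block : ∀ K M → block K M ≡ ∑ (f ∘ (K ,_)) 1 M
  ∑-block K M = trans (cong sum (sym (map-∘ (oneTo M)))) (sum-map-oneTo (f ∘ (K ,_)) M)

sum-cong-∈ : ∀ {A : Set} {f g : A → ℕ} xs → (∀ {x} → x ∈ xs → f x ≡ g x) →
             sum (map f xs) ≡ sum (map g xs)
sum-cong-∈ xs f≡g = cong sum (map-cong-local (All.tabulate f≡g))

closedForm : ℕ → ℕ → ℕ
closedForm n t = 48 * (n * n * n) + 64 * (n * n) + 5 * n + n * (4 * t)

block-polynomial : ∀ n t →
  (2 * n * (9 * (n * n)) + (9 * (2 * n * (2 * n + n * n) + n) + n * (6 * (2 * n + n * n))))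
  + ((9 * (2 * n * (2 * n + n * n) + n) + (2 * n * (9 * (n * n)) + n * (6 * (2 * n + n * n))))
     + (n * (6 * (2 * n + n * n)) + n * (6 * (2 * n + n * n))))
  + 4 * (n * (2 * (n + t)))
  ≡ 2 * (48 * (n * n * n) + 64 * (n * n) + 5 * n + n * (4 * t)) + 4 * (n * 2)
block-polynomial = solve-∀

-- The graph P_n

module _ {n : ℕ} where

  Adj-sym : ∀ {a b} → Adj n a b → Adj n b a
  Adj-sym (inj₁ e) = inj₂ e
  Adj-sym (inj₂ e) = inj₁ e

  _++ᵂ_ : ∀ {a b c k l} → Walk n a b k → Walk n b c l → Walk n a c (k + l)
  here        ++ᵂ q = q
  step adj p  ++ᵂ q = step adj (p ++ᵂ q)

  reverseᵂ : ∀ {a b k} → Walk n a b k → Walk n b a k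
  reverseᵂ here = here
  reverseᵂ {k = suc k} (step adj p) =
    subst (Walk n _ _) (+-comm k 1) (reverseᵂ p ++ᵂ step (Adj-sym adj) here)

module Pentagonal (n : ℕ) (2≤n : 2 ≤ n) where

  2n : ℕ
  2n = 2 * n

  2≤2n : 2 ≤ 2n
  2≤2n = ≤-trans 2≤n (m≤m+n n (n + 0))

  2n∈ : 2n ∈[1, 2n ]
  2n∈ = ≤-trans (s≤s z≤n) 2≤2n , ≤-refl

  double∈ : ∀ {k} → k ∈[1, n ] → 2 * k ∈[1, 2n ]
  double∈ {k} (1≤k , k≤n) = ≤-trans 1≤k (m≤m+n k (k + 0)) , *-monoʳ-≤ 2 k≤n

  data IsVertex : V → Set where
    u  : ∀ {i} → i ∈[1, 2n ] → IsVertex (U , i)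
    u' : ∀ {i} → i ∈[1, 2n ] → IsVertex (U' , i)
    w  : ∀ {k} → k ∈[1, n ] → IsVertex (W , k)

  data Ring : Kind → Set where
    ring-U  : Ring U
    ring-U' : Ring U'

  data Edge : V → V → Set where
    cycle : ∀ {K i} → Ring K → i ∈[1, 2n ] → Edge (K , i) (K , next 2n i)
    rung  : ∀ {k} → k < n → Edge (U , suc (k + k)) (U' , suc (k + k))
    uw    : ∀ {k} → k ∈[1, n ] → Edge (U , 2 * k) (W , k)
    wu'   : ∀ {k} → k ∈[1, n ] → Edge (W , k) (U' , 2 * k)

  ∈vertices⇒IsVertex : ∀ {a} → a ∈ vertices n → IsVertex a
  ∈vertices⇒IsVertex p with ∈-++⁻ (map (U ,_) (oneTo 2n)) p
  ... | inj₁ q with ∈-map⁻ (U ,_) q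
  ...   | _ , i∈ , refl = u (oneTo⁻ i∈)
  ∈vertices⇒IsVertex p | inj₂ p' with ∈-++⁻ (map (U' ,_) (oneTo 2n)) p'
  ... | inj₁ q with ∈-map⁻ (U' ,_) q
  ...   | _ , i∈ , refl = u' (oneTo⁻ i∈)
  ∈vertices⇒IsVertex p | inj₂ p' | inj₂ q with ∈-map⁻ (W ,_) q
  ... | _ , k∈ , refl = w (oneTo⁻ k∈)

  private
    path : Kind → List (V × V)
    path K = map (λ k → ((K , k) , (K , suc k))) (oneTo (2n ∸ 1))

    rungs spokesU spokesU' : List (V × V)
    rungs    = map (λ k → ((U , 2 * k ∸ 1) , (U' , 2 * k ∸ 1))) (oneTo n)
    spokesU  = map (λ k → ((U , 2 * k) , (W , k))) (oneTo n)
    spokesU' = map (λ k → ((W , k) , (U' , 2 * k))) (oneTo n)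

    rung-index : ∀ k → 2 * suc k ∸ 1 ≡ suc (k + k)
    rung-index k = trans (cong (k +_) (+-identityʳ (suc k))) (+-suc k k)

    ≤pred⇒< : ∀ {k M} → k ∈[1, M ∸ 1 ] → k < M
    ≤pred⇒< {M = zero}  (s≤s _ , ())
    ≤pred⇒< {M = suc M} (_ , k≤M) = s≤s k≤M

    path-edge : ∀ {K a b} → Ring K → (a , b) ∈ path K → Edge a b
    path-edge {K} r p with ∈-map⁻ (λ k → ((K , k) , (K , suc k))) p
    ... | k , k∈ , refl =
      let k<2n = ≤pred⇒< (oneTo⁻ k∈) in
      subst (λ z → Edge (K , k) (K , z)) (next-< k<2n) (cycle r (proj₁ (oneTo⁻ k∈) , <⇒≤ k<2n))

    closing-edge : ∀ {K} → Ring K → Edge (K , 2n) (K , 1)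
    closing-edge r = subst (λ z → Edge (_ , 2n) (_ , z)) (next-last 2n) (cycle r 2n∈)

  ∈edges⇒Edge : ∀ {a b} → (a , b) ∈ edges n → Edge a b
  ∈edges⇒Edge p with ∈-++⁻ (path U) p
  ... | inj₁ q = path-edge ring-U q
  ... | inj₂ p₁ with ∈-++⁻ (path U') p₁
  ...   | inj₁ q = path-edge ring-U' q
  ...   | inj₂ (here refl)         = closing-edge ring-U
  ...   | inj₂ (there (here refl)) = closing-edge ring-U'
  ...   | inj₂ (there (there p₂)) with ∈-++⁻ rungs p₂
  ...     | inj₁ q with ∈-map⁻ (λ k → ((U , 2 * k ∸ 1) , (U' , 2 * k ∸ 1))) q
  ...       | suc k , k∈ , refl rewrite rung-index k = rung (proj₂ (oneTo⁻ k∈))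
  ...       | zero  , k∈ , refl with () ← proj₁ (oneTo⁻ k∈)
  ∈edges⇒Edge p | inj₂ _ | inj₂ (there (there _)) | inj₂ p₃ with ∈-++⁻ spokesU p₃
  ... | inj₁ q with ∈-map⁻ (λ k → ((U , 2 * k) , (W , k))) q
  ...   | _ , k∈ , refl = uw (oneTo⁻ k∈)
  ∈edges⇒Edge p | inj₂ _ | inj₂ (there (there _)) | inj₂ _ | inj₂ q
    with ∈-map⁻ (λ k → ((W , k) , (U' , 2 * k))) q
  ... | _ , k∈ , refl = wu' (oneTo⁻ k∈)

  private
    path-∈ : ∀ {K x} → Ring K → x ∈ path K → x ∈ edges n
    path-∈ ring-U  p = ∈-++⁺ˡ p
    path-∈ ring-U' p = ∈-++⁺ʳ (path U) (∈-++⁺ˡ p)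

    closing-∈ : ∀ {K} → Ring K → ((K , 2n) , (K , 1)) ∈ edges n
    closing-∈ ring-U  = ∈-++⁺ʳ (path U) (∈-++⁺ʳ (path U') (here refl))
    closing-∈ ring-U' = ∈-++⁺ʳ (path U) (∈-++⁺ʳ (path U') (there (here refl)))

    tail-∈ : ∀ {x} → x ∈ rungs ++ spokesU ++ spokesU' → x ∈ edges n
    tail-∈ p = ∈-++⁺ʳ (path U) (∈-++⁺ʳ (path U') (there (there p)))

  Edge⇒∈edges : ∀ {a b} → Edge a b → (a , b) ∈ edges n
  Edge⇒∈edges (cycle {K} {i} r (1≤i , i≤2n)) with m≤n⇒m<n∨m≡n i≤2n
  ... | inj₁ i<2n rewrite next-< i<2n =
    path-∈ r (∈-map⁺ (λ k → ((K , k) , (K , suc k))) (oneTo⁺ (1≤i , suc[m]≤n⇒m≤pred[n] i<2n)))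
  ... | inj₂ refl rewrite next-last 2n = closing-∈ r
  Edge⇒∈edges (rung {k} k<n) = tail-∈ (∈-++⁺ˡ
    (subst (λ z → ((U , z) , (U' , z)) ∈ rungs) (rung-index k)
      (∈-map⁺ (λ k → ((U , 2 * k ∸ 1) , (U' , 2 * k ∸ 1))) (oneTo⁺ (s≤s z≤n , k<n)))))
  Edge⇒∈edges (uw k∈) =
    tail-∈ (∈-++⁺ʳ rungs (∈-++⁺ˡ (∈-map⁺ (λ k → ((U , 2 * k) , (W , k))) (oneTo⁺ k∈))))
  Edge⇒∈edges (wu' k∈) =
    tail-∈ (∈-++⁺ʳ rungs (∈-++⁺ʳ spokesU (∈-map⁺ (λ k → ((W , k) , (U' , 2 * k))) (oneTo⁺ k∈))))

  Edge⇒Adj : ∀ {a b} → Edge a b → Adj n a b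
  Edge⇒Adj e = inj₁ (Edge⇒∈edges e)

  Edge⇒Adj˘ : ∀ {a b} → Edge a b → Adj n b a
  Edge⇒Adj˘ e = inj₂ (Edge⇒∈edges e)

  Adj⇒Edge : ∀ {a b} → Adj n a b → Edge a b ⊎ Edge b a
  Adj⇒Edge (inj₁ p) = inj₁ (∈edges⇒Edge p)
  Adj⇒Edge (inj₂ p) = inj₂ (∈edges⇒Edge p)

  -- u_i and u'_i are joined by a rung when i is odd, and by the path through w_{i/2} when i is even.
  detour : ℕ → ℕ → ℕ
  detour i j = 𝟙 ((i ≡ᵇ j) ∧ even i)

  cross : ℕ → ℕ → ℕ
  cross i j = cyc 2n i j + detour i j

  wDist : ℕ → ℕ → ℕ
  wDist k l = if k ≡ᵇ l then 0 else 2 + cyc 2n (2 * k) (2 * l)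

  δ : V → V → ℕ
  δ (U  , i) (U  , j) = cyc 2n i j
  δ (U  , i) (U' , j) = suc (cross i j)
  δ (U  , i) (W  , k) = suc (cyc 2n i (2 * k))
  δ (U' , i) (U  , j) = suc (cross i j)
  δ (U' , i) (U' , j) = cyc 2n i j
  δ (U' , i) (W  , k) = suc (cyc 2n i (2 * k))
  δ (W  , k) (U  , j) = suc (cyc 2n (2 * k) j)
  δ (W  , k) (U' , j) = suc (cyc 2n (2 * k) j)
  δ (W  , k) (W  , l) = wDist k l

  δ-refl : ∀ a → δ a a ≡ 0
  δ-refl (U  , i) = cyc-refl 2n i
  δ-refl (U' , i) = cyc-refl 2n i
  δ-refl (W  , k) rewrite ≡ᵇ-refl k = refl

  detour≤1 : ∀ i j → detour i j ≤ 1
  detour≤1 i j with (i ≡ᵇ j) ∧ even i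
  ... | true  = ≤-refl
  ... | false = z≤n

  detour-sym : ∀ i j → detour i j ≡ detour j i
  detour-sym i j with i ≟ j
  ... | yes refl = refl
  ... | no  i≢j rewrite ≢⇒≡ᵇ-false i≢j | ≢⇒≡ᵇ-false (i≢j ∘ sym) = refl

  detour-odd : ∀ {i} j → even i ≡ false → detour i j ≡ 0
  detour-odd {i} j odd rewrite odd with i ≡ᵇ j
  ... | true  = refl
  ... | false = refl

  cross-odd : ∀ {i} j → even i ≡ false → cross i j ≡ cyc 2n i j
  cross-odd {i} j odd = trans (cong (cyc 2n i j +_) (detour-odd {i} j odd)) (+-identityʳ _)

  cross-≢ : ∀ {i j} → i ≢ j → cross i j ≡ cyc 2n i j
  cross-≢ {i} {j} i≢j rewrite ≢⇒≡ᵇ-false i≢j = +-identityʳ _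

  cross-even-refl : ∀ i → even i ≡ true → cross i i ≡ 1
  cross-even-refl i ev rewrite cyc-refl 2n i | ≡ᵇ-refl i | ev = refl

  detour≡0⊎cyc≡0 : ∀ i j → detour i j ≡ 0 ⊎ cyc 2n i j ≡ 0
  detour≡0⊎cyc≡0 i j with i ≟ j
  ... | yes refl = inj₂ (cyc-refl 2n i)
  ... | no  i≢j rewrite ≢⇒≡ᵇ-false i≢j = inj₁ refl

  cross-sym : ∀ i j → cross i j ≡ cross j i
  cross-sym i j = cong₂ _+_ (cyc-sym 2n i j) (detour-sym i j)

  infix 4 _≈₁_
  _≈₁_ : ℕ → ℕ → Set
  x ≈₁ y = x ≤ suc y × y ≤ suc x

  ≈₁-refl : ∀ {x} → x ≈₁ x
  ≈₁-refl = n≤1+n _ , n≤1+n _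

  ≈₁-sym : ∀ {x y} → x ≈₁ y → y ≈₁ x
  ≈₁-sym (p , q) = q , p

  ≈₁-suc : ∀ {x y} → x ≈₁ y → suc x ≈₁ suc y
  ≈₁-suc (p , q) = s≤s p , s≤s q

  ≈₁-next : ∀ x → x ≈₁ suc x
  ≈₁-next x = m≤n⇒m≤1+n (n≤1+n x) , ≤-refl

  +-≤1-≈₁ : ∀ x {e} → e ≤ 1 → x + e ≈₁ x
  +-≤1-≈₁ x e≤1 = ≤-trans (+-monoʳ-≤ x e≤1) (≤-reflexive (+-comm x 1)) , ≤-trans (m≤m+n x _) (n≤1+n _)

  cross-next : ∀ {i j} → i ∈[1, 2n ] → j ∈[1, 2n ] → cross i j ≈₁ cross (next 2n i) j
  cross-next {i} {j} i∈ j∈ =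
    let (p , q) = cyc-next 2≤2n i∈ j∈ in
    add-detour p (detour≤1 i j) (detour≡0⊎cyc≡0 i j) ,
    add-detour q (detour≤1 (next 2n i) j) (detour≡0⊎cyc≡0 (next 2n i) j)
    where
    add-detour : ∀ {x y e e'} → x ≤ suc y → e ≤ 1 → e ≡ 0 ⊎ x ≡ 0 → x + e ≤ suc (y + e')
    add-detour {x} {y} {e' = e'} x≤1+y _ (inj₁ refl) =
      ≤-trans (≤-reflexive (+-identityʳ x)) (≤-trans x≤1+y (s≤s (m≤m+n y e')))
    add-detour _ e≤1 (inj₂ refl) = ≤-trans e≤1 (s≤s z≤n)

  wDist-≈₁ : ∀ k l → suc (cyc 2n (2 * k) (2 * l)) ≈₁ wDist k l
  wDist-≈₁ k l with k ≟ l
  ... | yes refl rewrite ≡ᵇ-refl k | cyc-refl 2n (2 * k) = ≤-refl , z≤n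
  ... | no  k≢l  rewrite ≢⇒≡ᵇ-false k≢l = ≈₁-next _

  δ-edge : ∀ {a b z} → Edge a b → IsVertex z → δ a z ≈₁ δ b z
  δ-edge (cycle ring-U  i∈) (u  j∈) = cyc-next 2≤2n i∈ j∈
  δ-edge (cycle ring-U  i∈) (u' j∈) = ≈₁-suc (cross-next i∈ j∈)
  δ-edge (cycle ring-U  i∈) (w  k∈) = ≈₁-suc (cyc-next 2≤2n i∈ (double∈ k∈))
  δ-edge (cycle ring-U' i∈) (u  j∈) = ≈₁-suc (cross-next i∈ j∈)
  δ-edge (cycle ring-U' i∈) (u' j∈) = cyc-next 2≤2n i∈ j∈
  δ-edge (cycle ring-U' i∈) (w  k∈) = ≈₁-suc (cyc-next 2≤2n i∈ (double∈ k∈))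
  δ-edge (rung {k} _) (u {j} _) =
    subst (λ x → cyc 2n (suc (k + k)) j ≈₁ suc x) (sym (cross-odd j (even-suc-double k))) (≈₁-next _)
  δ-edge (rung {k} _) (u' {j} _) =
    subst (λ x → suc x ≈₁ cyc 2n (suc (k + k)) j) (sym (cross-odd j (even-suc-double k))) (≈₁-sym (≈₁-next _))
  δ-edge (rung _) (w _) = ≈₁-refl
  δ-edge (uw _) (u _) = ≈₁-next _
  δ-edge (uw {k} _) (u' {j} _) = ≈₁-suc (+-≤1-≈₁ _ (detour≤1 (2 * k) j))
  δ-edge (uw {k} _) (w {l} _) = wDist-≈₁ k l
  δ-edge (wu' {k} _) (u {j} _) = ≈₁-sym (≈₁-suc (+-≤1-≈₁ _ (detour≤1 (2 * k) j)))
  δ-edge (wu' _) (u' _) = ≈₁-sym (≈₁-next _)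
  δ-edge (wu' {k} _) (w {l} _) = ≈₁-sym (wDist-≈₁ k l)

  δ≤length : ∀ {a z k} → IsVertex z → Walk n a z k → δ a z ≤ k
  δ≤length {z = z} _ here = ≤-reflexive (δ-refl z)
  δ≤length z∈ (step adj walk) with Adj⇒Edge adj
  ... | inj₁ e = ≤-trans (proj₁ (δ-edge e z∈)) (s≤s (δ≤length z∈ walk))
  ... | inj₂ e = ≤-trans (proj₂ (δ-edge e z∈)) (s≤s (δ≤length z∈ walk))

  edgeᵂ : ∀ {a b} → Edge a b → Walk n a b 1
  edgeᵂ e = step (Edge⇒Adj e) here

  edgeᵂ˘ : ∀ {a b} → Edge a b → Walk n b a 1
  edgeᵂ˘ e = step (Edge⇒Adj˘ e) here

  forwardᵂ : ∀ {K} → Ring K → ∀ d {i} → 1 ≤ i → i + d ≤ 2n → Walk n (K , i) (K , i + d) d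
  forwardᵂ {K} r zero {i} _ _ = subst (λ z → Walk n (K , i) (K , z) 0) (sym (+-identityʳ i)) here
  forwardᵂ {K} r (suc d) {i} 1≤i i+d<2n =
    subst (λ z → Walk n (K , i) (K , z) (suc d)) (sym (+-suc i d)) (edgeᵂ e ++ᵂ forwardᵂ r d z<s i+1+d≤2n)
    where
    i+1+d≤2n : suc i + d ≤ 2n
    i+1+d≤2n = subst (_≤ 2n) (+-suc i d) i+d<2n
    i<2n : i < 2n
    i<2n = ≤-trans (s≤s (m≤m+n i d)) i+1+d≤2n
    e : Edge (K , i) (K , suc i)
    e = subst (λ z → Edge (K , i) (K , z)) (next-< i<2n) (cycle r (1≤i , <⇒≤ i<2n))

  stepsᵂ : ∀ {K i j} → Ring K → i ∈[1, 2n ] → j ∈[1, 2n ] → Walk n (K , i) (K , j) (steps 2n i j)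
  stepsᵂ {K} {i} {j} r (1≤i , i≤2n) (1≤j , j≤2n) with ≤-<-connex i j
  ... | inj₁ i≤j = subst₂ (λ z l → Walk n (K , i) (K , z) l) (m+[n∸m]≡n i≤j) (sym (steps-≤ 2n i≤j))
    (forwardᵂ r (j ∸ i) 1≤i (≤-trans (≤-reflexive (m+[n∸m]≡n i≤j)) j≤2n))
  ... | inj₂ j<i = subst (Walk n (K , i) (K , j)) len≡ (to-2n ++ᵂ (edgeᵂ closing ++ᵂ from-1))
    where
    to-2n : Walk n (K , i) (K , 2n) (2n ∸ i)
    to-2n = subst (λ z → Walk n (K , i) (K , z) (2n ∸ i)) (m+[n∸m]≡n i≤2n)
      (forwardᵂ r (2n ∸ i) 1≤i (≤-reflexive (m+[n∸m]≡n i≤2n)))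
    closing : Edge (K , 2n) (K , 1)
    closing = subst (λ z → Edge (K , 2n) (K , z)) (next-last 2n) (cycle r 2n∈)
    from-1 : Walk n (K , 1) (K , j) (j ∸ 1)
    from-1 = subst (λ z → Walk n (K , 1) (K , z) (j ∸ 1)) (m+[n∸m]≡n 1≤j)
      (forwardᵂ r (j ∸ 1) ≤-refl (≤-trans (≤-reflexive (m+[n∸m]≡n 1≤j)) j≤2n))
    len≡ : 2n ∸ i + suc (j ∸ 1) ≡ steps 2n i j
    len≡ = trans (cong (2n ∸ i +_) (m+[n∸m]≡n 1≤j)) (trans (sym (+-∸-comm j i≤2n)) (sym (steps-> 2n j<i)))

  cycᵂ : ∀ {K i j} → Ring K → i ∈[1, 2n ] → j ∈[1, 2n ] → Walk n (K , i) (K , j) (cyc 2n i j)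
  cycᵂ {K} {i} {j} r i∈ j∈ with ≤-<-connex (steps 2n i j) (steps 2n j i)
  ... | inj₁ ≤ = subst (Walk n (K , i) (K , j)) (sym (m≤n⇒m⊓n≡m ≤)) (stepsᵂ r i∈ j∈)
  ... | inj₂ > = subst (Walk n (K , i) (K , j)) (sym (m≥n⇒m⊓n≡n (<⇒≤ >))) (reverseᵂ (stepsᵂ r j∈ i∈))

  odd-rung : ∀ {i} → even i ≡ false → i ≤ 2n → Edge (U , i) (U' , i)
  odd-rung {i} odd i≤2n with odd⇒double i odd
  ... | k , refl = rung (*-cancelˡ-< 2 k n (subst (_< 2n) (sym (2*-double k)) i≤2n))

  even-half : ∀ {i} → even i ≡ true → i ∈[1, 2n ] → ∃ λ k → i ≡ 2 * k × k ∈[1, n ]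
  even-half {i} ev (1≤i , i≤2n) with even⇒double i ev
  ... | zero  , refl with () ← 1≤i
  ... | suc k , refl = suc k , refl , z<s , *-cancelˡ-≤ 2 i≤2n

  next-odd : ∀ {i} → even i ≡ true → i ∈[1, 2n ] → even (next 2n i) ≡ false
  next-odd {i} ev (_ , i≤2n) with m≤n⇒m<n∨m≡n i≤2n
  ... | inj₁ i<2n rewrite next-< i<2n | even-suc i | ev = refl
  ... | inj₂ refl rewrite next-last i = refl

  even-prev : ∀ {i} → even i ≡ true → i ∈[1, 2n ] →
              ∃ λ p → p ∈[1, 2n ] × next 2n p ≡ i × even p ≡ false
  even-prev {suc (suc p)} ev (_ , i≤2n) = suc p , (z<s , <⇒≤ i≤2n) , next-< i≤2n , trans (even-suc p) (cong not ev)

  -- For even i ≠ j, the walk first moves along the U-cycle towards j, to an odd label with a rung.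
  crossᵂ : ∀ {i j} → i ∈[1, 2n ] → j ∈[1, 2n ] → Walk n (U , i) (U' , j) (suc (cross i j))
  crossᵂ {i} {j} i∈ j∈ with even-or-odd i
  ... | inj₂ odd = subst (Walk n (U , i) (U' , j)) (cong suc (sym (cross-odd j odd)))
    (edgeᵂ (odd-rung odd (proj₂ i∈)) ++ᵂ cycᵂ ring-U' i∈ j∈)
  ... | inj₁ ev with i ≟ j
  ...   | yes refl with even-half ev i∈
  ...     | k , refl , k∈ = subst (Walk n (U , 2 * k) (U' , 2 * k)) (cong suc (sym (cross-even-refl (2 * k) ev)))
    (edgeᵂ (uw k∈) ++ᵂ edgeᵂ (wu' k∈))
  crossᵂ {i} {j} i∈ j∈ | inj₁ ev | no i≢j with ≤-<-connex (steps 2n i j) (steps 2n j i)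
  ... | inj₁ ≤ = subst (Walk n (U , i) (U' , j)) (cong suc (sym len≡))
    (edgeᵂ (cycle ring-U i∈) ++ᵂ
      (edgeᵂ (odd-rung (next-odd ev i∈) (proj₂ i'∈)) ++ᵂ stepsᵂ ring-U' i'∈ j∈))
    where
    i'∈ = next-range i∈
    len≡ : cross i j ≡ suc (steps 2n (next 2n i) j)
    len≡ = trans (cross-≢ i≢j) (trans (m≤n⇒m⊓n≡m ≤) (steps-next-source i∈ j∈ i≢j))
  ... | inj₂ > with even-prev ev i∈
  ...   | p , p∈ , refl , odd =
    subst (Walk n (U , next 2n p) (U' , j)) len≡ (reverseᵂ
      (stepsᵂ ring-U' j∈ p∈ ++ᵂ (edgeᵂ˘ (odd-rung odd (proj₂ p∈)) ++ᵂ edgeᵂ (cycle ring-U p∈))))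
    where
    len≡ : steps 2n j p + 2 ≡ suc (cross (next 2n p) j)
    len≡ = begin
      steps 2n j p + 2               ≡⟨ +-comm (steps 2n j p) 2 ⟩
      suc (suc (steps 2n j p))       ≡⟨ cong suc (steps-next-target p∈ j∈ i≢j) ⟨
      suc (steps 2n j (next 2n p))   ≡⟨ cong suc (m≥n⇒m⊓n≡n (<⇒≤ >)) ⟨
      suc (cyc 2n (next 2n p) j)     ≡⟨ cong suc (cross-≢ i≢j) ⟨
      suc (cross (next 2n p) j)      ∎
      where open ≡-Reasoning

  δᵂ : ∀ {a b} → IsVertex a → IsVertex b → Walk n a b (δ a b)
  δᵂ (u i∈) (u j∈) = cycᵂ ring-U i∈ j∈
  δᵂ (u i∈) (u' j∈) = crossᵂ i∈ j∈
  δᵂ (u i∈) (w k∈) = subst (Walk n _ _) (+-comm _ 1) (cycᵂ ring-U i∈ (double∈ k∈) ++ᵂ edgeᵂ (uw k∈))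
  δᵂ (u' {i} i∈) (u {j} j∈) = subst (Walk n _ _) (cong suc (cross-sym j i)) (reverseᵂ (crossᵂ j∈ i∈))
  δᵂ (u' i∈) (u' j∈) = cycᵂ ring-U' i∈ j∈
  δᵂ (u' i∈) (w k∈) = subst (Walk n _ _) (+-comm _ 1) (cycᵂ ring-U' i∈ (double∈ k∈) ++ᵂ edgeᵂ˘ (wu' k∈))
  δᵂ (w {k} k∈) (u {j} j∈) =
    subst (Walk n _ _) (cong suc (cyc-sym 2n j (2 * k))) (reverseᵂ (δᵂ (u j∈) (w k∈)))
  δᵂ (w {k} k∈) (u' {j} j∈) =
    subst (Walk n _ _) (cong suc (cyc-sym 2n j (2 * k))) (reverseᵂ (δᵂ (u' j∈) (w k∈)))
  δᵂ (w {k} k∈) (w {l} l∈) with k ≟ l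
  ... | yes refl rewrite ≡ᵇ-refl k = here
  ... | no  k≢l  rewrite ≢⇒≡ᵇ-false k≢l = subst (Walk n _ _) (cong suc (+-comm _ 1))
    (edgeᵂ˘ (uw k∈) ++ᵂ (cycᵂ ring-U (double∈ k∈) (double∈ l∈) ++ᵂ edgeᵂ (uw l∈)))

  IsDist⇒≡δ : ∀ {a b d} → IsVertex a → IsVertex b → IsDist n a b d → d ≡ δ a b
  IsDist⇒≡δ a∈ b∈ (walk , shortest) = ≤-antisym (shortest _ (δᵂ a∈ b∈)) (δ≤length b∈ walk)

  Adj-ring : ∀ {K i j} → Adj n (K , i) (K , j) → j ≡ next 2n i ⊎ i ≡ next 2n j
  Adj-ring adj with Adj⇒Edge adj
  ... | inj₁ (cycle _ _) = inj₁ refl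
  ... | inj₂ (cycle _ _) = inj₂ refl

  Adj-U-U' : ∀ {i j} → Adj n (U , i) (U' , j) → j ≡ i × even i ≡ false
  Adj-U-U' adj with Adj⇒Edge adj
  ... | inj₁ (rung {k} _) = refl , even-suc-double k

  Adj-U'-U : ∀ {i j} → Adj n (U' , i) (U , j) → j ≡ i × even i ≡ false
  Adj-U'-U adj with Adj-U-U' (Adj-sym {n} adj)
  ... | refl , odd = refl , odd

  Adj-U-W : ∀ {i k} → Adj n (U , i) (W , k) → i ≡ 2 * k
  Adj-U-W adj with Adj⇒Edge adj
  ... | inj₁ (uw _) = refl

  Adj-U'-W : ∀ {i k} → Adj n (U' , i) (W , k) → i ≡ 2 * k
  Adj-U'-W adj with Adj⇒Edge adj
  ... | inj₂ (wu' _) = refl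

  ¬Adj-W-W : ∀ {k l} → ¬ Adj n (W , k) (W , l)
  ¬Adj-W-W adj with Adj⇒Edge adj
  ... | inj₁ (cycle () _)
  ... | inj₂ (cycle () _)

  -- Degrees

  adj : V → V → ℕ
  adj a b = 𝟙 (does (Adj? n a b))

  deg≡∑adj : ∀ a → deg n a ≡ ∑ (adj a ∘ (U ,_)) 1 2n + (∑ (adj a ∘ (U' ,_)) 1 2n + ∑ (adj a ∘ (W ,_)) 1 n)
  deg≡∑adj a = trans (length-filter≡sum (Adj? n a) (vertices n)) (sum-vertices n (adj a))

  adj≡𝟙-≡ : ∀ {a} (b : ℕ → V) {x} j → Adj n a (b x) → (Adj n a (b j) → j ≡ x) →
            adj a (b j) ≡ 𝟙 (j ≡ᵇ x)
  adj≡𝟙-≡ {a} b {x} j adj-x adj⇒≡ with j ≟ x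
  ... | yes refl = cong 𝟙 (trans (dec-true (Adj? n a (b j)) adj-x) (sym (≡ᵇ-refl j)))
  ... | no  j≢x  = cong 𝟙 (trans (dec-false (Adj? n a (b j)) (j≢x ∘ adj⇒≡)) (sym (≢⇒≡ᵇ-false j≢x)))

  ∑adj-one : ∀ {a} (b : ℕ → V) {x M} → x ∈[1, M ] → Adj n a (b x) → (∀ {j} → Adj n a (b j) → j ≡ x) →
             ∑ (adj a ∘ b) 1 M ≡ 1
  ∑adj-one b {M = M} x∈ adj-x adj⇒≡ =
    trans (∑-cong 1 M (λ j → adj≡𝟙-≡ b j adj-x adj⇒≡)) (∑-𝟙-≡ x∈)

  ∑adj-none : ∀ {a} (b : ℕ → V) M → (∀ {j} → ¬ Adj n a (b j)) → ∑ (adj a ∘ b) 1 M ≡ 0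
  ∑adj-none {a} b M ¬adj = ∑-zero (adj a ∘ b) 1 M (λ j _ _ → cong 𝟙 (dec-false (Adj? n a (b j)) ¬adj))

  prev : ℕ → ℕ
  prev (suc (suc i)) = suc i
  prev _             = 2n

  prev-range : ∀ {i} → i ∈[1, 2n ] → prev i ∈[1, 2n ]
  prev-range {suc zero}    _          = 2n∈
  prev-range {suc (suc i)} (_ , i<2n) = z<s , <⇒≤ i<2n

  next-prev : ∀ {i} → i ∈[1, 2n ] → next 2n (prev i) ≡ i
  next-prev {suc zero}    _          = next-last 2n
  next-prev {suc (suc i)} (_ , i<2n) = next-< i<2n

  next≡⇒≡prev : ∀ {i j} → j ∈[1, 2n ] → next 2n j ≡ i → j ≡ prev i
  next≡⇒≡prev {i} {j} (1≤j , j≤2n) eq with m≤n⇒m<n∨m≡n j≤2n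
  ... | inj₁ j<2n with trans (sym (next-< j<2n)) eq | 1≤j
  ...   | refl | s≤s _ = refl
  next≡⇒≡prev {i} {j} (1≤j , j≤2n) eq | inj₂ refl with trans (sym (next-last j)) eq
  ...   | refl = refl

  2≢2n : 2 ≢ 2n
  2≢2n 2≡2n = <⇒≱ (s≤s (s≤s (s≤s z≤n))) (subst (4 ≤_) (sym 2≡2n) (*-monoʳ-≤ 2 2≤n))

  next≢prev : ∀ {i} → i ∈[1, 2n ] → next 2n i ≢ prev i
  next≢prev {suc zero} _ eq = 2≢2n (trans (sym (next-< 2≤2n)) eq)
  next≢prev {suc (suc k)} (_ , i≤2n) eq with m≤n⇒m<n∨m≡n i≤2n
  ... | inj₁ i<2n with () ← trans (sym (next-< i<2n)) eq
  ... | inj₂ i≡2n with trans (sym (next-last 2n)) (trans (cong (next 2n) (sym i≡2n)) eq)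
  ...   | refl = 2≢2n i≡2n

  adj-ring : ∀ {K i} j → Ring K → i ∈[1, 2n ] → j ∈[1, 2n ] →
             adj (K , i) (K , j) ≡ 𝟙 (j ≡ᵇ next 2n i) + 𝟙 (j ≡ᵇ prev i)
  adj-ring {K} {i} j r i∈ j∈ with j ≟ next 2n i | j ≟ prev i
  ... | yes refl | _ rewrite ≡ᵇ-refl (next 2n i) | ≢⇒≡ᵇ-false (next≢prev i∈) =
    cong 𝟙 (dec-true (Adj? n _ _) (Edge⇒Adj (cycle r i∈)))
  ... | no j≢next | yes refl rewrite ≢⇒≡ᵇ-false j≢next | ≡ᵇ-refl (prev i) =
    cong 𝟙 (dec-true (Adj? n _ _) (subst (λ z → Adj n (K , z) (K , prev i)) (next-prev i∈)
      (Edge⇒Adj˘ (cycle r (prev-range i∈)))))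
  ... | no j≢next | no j≢prev rewrite ≢⇒≡ᵇ-false j≢next | ≢⇒≡ᵇ-false j≢prev =
    cong 𝟙 (dec-false (Adj? n _ _) ¬adj)
    where
    ¬adj : ¬ Adj n (K , i) (K , j)
    ¬adj a with Adj-ring a
    ... | inj₁ j≡next = j≢next j≡next
    ... | inj₂ i≡next = j≢prev (next≡⇒≡prev j∈ (sym i≡next))

  ∑adj-ring : ∀ {K i} → Ring K → i ∈[1, 2n ] → ∑ (adj (K , i) ∘ (K ,_)) 1 2n ≡ 2
  ∑adj-ring {K} {i} r i∈ = begin
    ∑ (adj (K , i) ∘ (K ,_)) 1 2n
      ≡⟨ ∑₁-cong 2n (λ {j} j∈ → adj-ring j r i∈ j∈) ⟩
    ∑ (λ j → 𝟙 (j ≡ᵇ next 2n i) + 𝟙 (j ≡ᵇ prev i)) 1 2n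
      ≡⟨ ∑-distrib-+ _ _ 1 2n ⟩
    ∑ (λ j → 𝟙 (j ≡ᵇ next 2n i)) 1 2n + ∑ (λ j → 𝟙 (j ≡ᵇ prev i)) 1 2n
      ≡⟨ cong₂ _+_ (∑-𝟙-≡ (next-range i∈)) (∑-𝟙-≡ (prev-range i∈)) ⟩
    2 ∎
    where open ≡-Reasoning

  weight : V → ℕ
  weight (U  , _) = 3
  weight (U' , _) = 3
  weight (W  , _) = 2

  deg≡weight : ∀ {a} → IsVertex a → deg n a ≡ weight a
  deg≡weight {U , i} (u i∈) with even-or-odd i
  ... | inj₂ odd = trans (deg≡∑adj (U , i)) (cong₂ _+_ (∑adj-ring ring-U i∈) (cong₂ _+_
    (∑adj-one (U' ,_) i∈ (Edge⇒Adj (odd-rung odd (proj₂ i∈))) (proj₁ ∘ Adj-U-U'))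
    (∑adj-none (W ,_) n λ {j} adj → odd≢2* j odd (Adj-U-W adj))))
  ... | inj₁ ev with even-half ev i∈
  ...   | k , refl , k∈ = trans (deg≡∑adj (U , 2 * k)) (cong₂ _+_ (∑adj-ring ring-U i∈) (cong₂ _+_
    (∑adj-none (U' ,_) 2n λ adj → not-¬ (even-2* k) (proj₂ (Adj-U-U' adj)))
    (∑adj-one (W ,_) k∈ (Edge⇒Adj (uw k∈)) λ adj → sym (*-cancelˡ-≡ _ _ 2 (Adj-U-W adj)))))
  deg≡weight {U' , i} (u' i∈) with even-or-odd i
  ... | inj₂ odd = trans (deg≡∑adj (U' , i)) (cong₂ _+_
    (∑adj-one (U ,_) i∈ (Edge⇒Adj˘ (odd-rung odd (proj₂ i∈))) (proj₁ ∘ Adj-U'-U))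
    (cong₂ _+_ (∑adj-ring ring-U' i∈) (∑adj-none (W ,_) n λ {j} adj → odd≢2* j odd (Adj-U'-W adj))))
  ... | inj₁ ev with even-half ev i∈
  ...   | k , refl , k∈ = trans (deg≡∑adj (U' , 2 * k)) (cong₂ _+_
    (∑adj-none (U ,_) 2n λ adj → not-¬ (even-2* k) (proj₂ (Adj-U'-U adj)))
    (cong₂ _+_ (∑adj-ring ring-U' i∈)
      (∑adj-one (W ,_) k∈ (Edge⇒Adj˘ (wu' k∈)) λ adj → sym (*-cancelˡ-≡ _ _ 2 (Adj-U'-W adj)))))
  deg≡weight {W , k} (w k∈) = trans (deg≡∑adj (W , k)) (cong₂ _+_
    (∑adj-one (U ,_) (double∈ k∈) (Edge⇒Adj˘ (uw k∈)) (Adj-U-W ∘ Adj-sym {n}))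
    (cong₂ _+_ (∑adj-one (U' ,_) (double∈ k∈) (Edge⇒Adj (wu' k∈)) (Adj-U'-W ∘ Adj-sym {n}))
      (∑adj-none (W ,_) n ¬Adj-W-W)))

  -- The Gutman sum

  ∑cyc-row : ∀ {i} → i ∈[1, 2n ] → ∑ (cyc 2n i) 1 2n ≡ n * n
  ∑cyc-row i∈ = trans (∑-cyc i∈) (trans (cong arcSum (2*-double n)) (arcSum-even n))

  detour-even : ∀ {i} j → even i ≡ true → detour i j ≡ 𝟙 (j ≡ᵇ i)
  detour-even {i} j ev with j ≟ i
  ... | yes refl rewrite ≡ᵇ-refl j | ev = refl
  ... | no  j≢i  rewrite ≢⇒≡ᵇ-false j≢i | ≢⇒≡ᵇ-false (j≢i ∘ sym) = refl

  ∑detour-row : ∀ {i} → i ∈[1, 2n ] → ∑ (detour i) 1 2n ≡ 𝟙 (even i)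
  ∑detour-row {i} i∈ with even-or-odd i
  ... | inj₁ ev = trans (∑-cong 1 2n (λ j → detour-even j ev))
    (trans (∑-𝟙-≡ i∈) (cong 𝟙 (sym ev)))
  ... | inj₂ odd = trans (∑-zero (detour i) 1 2n (λ j _ _ → detour-odd {i} j odd)) (cong 𝟙 (sym odd))

  ∑cross-row : ∀ {i} → i ∈[1, 2n ] → ∑ (cross i) 1 2n ≡ n * n + 𝟙 (even i)
  ∑cross-row i∈ = trans (∑-distrib-+ _ _ 1 2n) (cong₂ _+_ (∑cyc-row i∈) (∑detour-row i∈))

  wDist+2𝟙 : ∀ k l → wDist k l + 2 * 𝟙 (l ≡ᵇ k) ≡ 2 + 2 * cyc n k l
  wDist+2𝟙 k l with k ≟ l
  ... | yes refl rewrite ≡ᵇ-refl k | cyc-refl n k = refl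
  ... | no  k≢l  rewrite ≢⇒≡ᵇ-false k≢l | ≢⇒≡ᵇ-false (k≢l ∘ sym) | cyc-double n k l = +-identityʳ _

  ∑wDist-row : ∀ {k} → k ∈[1, n ] → ∑ (wDist k) 1 n + 2 ≡ 2 * (n + arcSum n)
  ∑wDist-row {k} k∈ = begin
    ∑ (wDist k) 1 n + 2
      ≡⟨ cong (∑ (wDist k) 1 n +_) (cong (2 *_) (∑-𝟙-≡ k∈)) ⟨
    ∑ (wDist k) 1 n + 2 * ∑ (λ l → 𝟙 (l ≡ᵇ k)) 1 n
      ≡⟨ cong (∑ (wDist k) 1 n +_) (∑-*ˡ 2 _ 1 n) ⟨
    ∑ (wDist k) 1 n + ∑ (λ l → 2 * 𝟙 (l ≡ᵇ k)) 1 n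
      ≡⟨ ∑-distrib-+ _ _ 1 n ⟨
    ∑ (λ l → wDist k l + 2 * 𝟙 (l ≡ᵇ k)) 1 n
      ≡⟨ ∑-cong 1 n (wDist+2𝟙 k) ⟩
    ∑ (λ l → 2 + 2 * cyc n k l) 1 n
      ≡⟨ ∑-distrib-+ _ _ 1 n ⟩
    ∑ (λ _ → 2) 1 n + ∑ (λ l → 2 * cyc n k l) 1 n
      ≡⟨ cong₂ _+_ (trans (∑-const 2 1 n) (*-comm n 2))
                   (trans (∑-*ˡ 2 (cyc n k) 1 n) (cong (2 *_) (∑-cyc k∈))) ⟩
    2 * n + 2 * arcSum n
      ≡⟨ *-distribˡ-+ 2 n (arcSum n) ⟨
    2 * (n + arcSum n) ∎
    where open ≡-Reasoning

  term : V → V → ℕ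
  term a b = weight a * weight b * δ a b

  ∑₃ : (V → ℕ) → ℕ
  ∑₃ g = ∑ (g ∘ (U ,_)) 1 2n + (∑ (g ∘ (U' ,_)) 1 2n + ∑ (g ∘ (W ,_)) 1 n)

  gutSum≡∑₃ : ∀ dist → (∀ a b → a ∈ vertices n → b ∈ vertices n → IsDist n a b (dist a b)) →
              gutSum n dist ≡ ∑₃ (λ a → ∑₃ (term a))
  gutSum≡∑₃ dist isDist = begin
    gutSum n dist
      ≡⟨ sum-cong-∈ (vertices n) (λ a∈ → sum-cong-∈ (vertices n) (λ b∈ →
           cong₂ _*_ (cong₂ _*_ (deg≡weight (∈vertices⇒IsVertex a∈)) (deg≡weight (∈vertices⇒IsVertex b∈)))
                     (IsDist⇒≡δ (∈vertices⇒IsVertex a∈) (∈vertices⇒IsVertex b∈) (isDist _ _ a∈ b∈)))) ⟩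
    sum (map (λ a → sum (map (term a) (vertices n))) (vertices n))
      ≡⟨ sum-vertices n _ ⟩
    ∑₃ (λ a → sum (map (term a) (vertices n)))
      ≡⟨ cong₂ _+_ (∑-cong 1 2n (λ i → sum-vertices n (term (U , i))))
           (cong₂ _+_ (∑-cong 1 2n (λ i → sum-vertices n (term (U' , i))))
                      (∑-cong 1 n (λ k → sum-vertices n (term (W , k))))) ⟩
    ∑₃ (λ a → ∑₃ (term a)) ∎
    where open ≡-Reasoning

  ∑-UU : ∑ (λ i → ∑ (λ j → 9 * cyc 2n i j) 1 2n) 1 2n ≡ 2n * (9 * (n * n))
  ∑-UU = trans (∑₁-cong 2n λ i∈ → trans (∑-*ˡ 9 _ 1 2n) (cong (9 *_) (∑cyc-row i∈))) (∑-const _ 1 2n)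

  ∑-UU' : ∑ (λ i → ∑ (λ j → 9 * suc (cross i j)) 1 2n) 1 2n ≡ 9 * (2n * (2n + n * n) + n)
  ∑-UU' = begin
    ∑ (λ i → ∑ (λ j → 9 * suc (cross i j)) 1 2n) 1 2n
      ≡⟨ ∑₁-cong 2n row ⟩
    ∑ (λ i → 9 * ((2n + n * n) + 𝟙 (even i))) 1 2n
      ≡⟨ ∑-*ˡ 9 _ 1 2n ⟩
    9 * ∑ (λ i → (2n + n * n) + 𝟙 (even i)) 1 2n
      ≡⟨ cong (9 *_) (trans (∑-distrib-+ _ _ 1 2n) (cong₂ _+_ (∑-const _ 1 2n) (∑-even n))) ⟩
    9 * (2n * (2n + n * n) + n) ∎
    where
    open ≡-Reasoning
    row : ∀ {i} → i ∈[1, 2n ] → ∑ (λ j → 9 * suc (cross i j)) 1 2n ≡ 9 * ((2n + n * n) + 𝟙 (even i))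
    row {i} i∈ = trans (∑-*ˡ 9 _ 1 2n) (cong (9 *_)
      (trans (∑-1+ (cross i) 1 2n) (trans (cong (2n +_) (∑cross-row i∈)) (sym (+-assoc 2n _ _)))))

  ∑-WU : ∑ (λ k → ∑ (λ j → 6 * suc (cyc 2n (2 * k) j)) 1 2n) 1 n ≡ n * (6 * (2n + n * n))
  ∑-WU = trans (∑₁-cong n row) (∑-const _ 1 n)
    where
    row : ∀ {k} → k ∈[1, n ] → ∑ (λ j → 6 * suc (cyc 2n (2 * k) j)) 1 2n ≡ 6 * (2n + n * n)
    row k∈ = trans (∑-*ˡ 6 _ 1 2n) (cong (6 *_) (trans (∑-1+ _ 1 2n) (cong (2n +_) (∑cyc-row (double∈ k∈)))))

  ∑-UW : ∑ (λ i → ∑ (λ k → 6 * suc (cyc 2n i (2 * k))) 1 n) 1 2n ≡ n * (6 * (2n + n * n))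
  ∑-UW = begin
    ∑ (λ i → ∑ (λ k → 6 * suc (cyc 2n i (2 * k))) 1 n) 1 2n
      ≡⟨ ∑-swap (λ i k → 6 * suc (cyc 2n i (2 * k))) 1 2n 1 n ⟩
    ∑ (λ k → ∑ (λ i → 6 * suc (cyc 2n i (2 * k))) 1 2n) 1 n
      ≡⟨ ∑-cong 1 n (λ k → ∑-cong 1 2n (λ i → cong (λ c → 6 * suc c) (cyc-sym 2n i (2 * k)))) ⟩
    ∑ (λ k → ∑ (λ j → 6 * suc (cyc 2n (2 * k) j)) 1 2n) 1 n
      ≡⟨ ∑-WU ⟩
    n * (6 * (2n + n * n)) ∎
    where open ≡-Reasoning

  ∑-WW : ∑ (λ k → ∑ (λ l → 4 * wDist k l) 1 n) 1 n + 4 * (n * 2) ≡ 4 * (n * (2 * (n + arcSum n)))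
  ∑-WW = begin
    ∑ (λ k → ∑ (λ l → 4 * wDist k l) 1 n) 1 n + 4 * (n * 2)
      ≡⟨ cong (_+ 4 * (n * 2)) (trans (∑-cong 1 n (λ k → ∑-*ˡ 4 (wDist k) 1 n)) (∑-*ˡ 4 _ 1 n)) ⟩
    4 * ∑ (λ k → ∑ (wDist k) 1 n) 1 n + 4 * (n * 2)
      ≡⟨ *-distribˡ-+ 4 (∑ (λ k → ∑ (wDist k) 1 n) 1 n) (n * 2) ⟨
    4 * (∑ (λ k → ∑ (wDist k) 1 n) 1 n + n * 2)
      ≡⟨ cong (λ z → 4 * (∑ (λ k → ∑ (wDist k) 1 n) 1 n + z)) (∑-const 2 1 n) ⟨
    4 * (∑ (λ k → ∑ (wDist k) 1 n) 1 n + ∑ (λ _ → 2) 1 n)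
      ≡⟨ cong (4 *_) (∑-distrib-+ _ _ 1 n) ⟨
    4 * ∑ (λ k → ∑ (wDist k) 1 n + 2) 1 n
      ≡⟨ cong (4 *_) (trans (∑₁-cong n ∑wDist-row) (∑-const _ 1 n)) ⟩
    4 * (n * (2 * (n + arcSum n))) ∎
    where open ≡-Reasoning

  -- Each W–W row sums to 2 (n + arcSum n) − 2, so 4 · 2n is added on both sides to avoid ∸.
  gutSum≡2*closedForm : ∀ dist → (∀ a b → a ∈ vertices n → b ∈ vertices n → IsDist n a b (dist a b)) →
                        gutSum n dist ≡ 2 * closedForm n (arcSum n)
  gutSum≡2*closedForm dist isDist = +-cancelʳ-≡ (4 * (n * 2)) _ _ (begin
    gutSum n dist + 4 * (n * 2)
      ≡⟨ cong (_+ 4 * (n * 2)) (trans (gutSum≡∑₃ dist isDist) blocks) ⟩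
    ((bUU + (bUU' + bUW)) + ((bUU' + (bUU + bUW)) + (bUW + (bUW + bWW)))) + 4 * (n * 2)
      ≡⟨ regroup bUU bUU' bUW bWW (4 * (n * 2)) ⟩
    ((bUU + (bUU' + bUW)) + ((bUU' + (bUU + bUW)) + (bUW + bUW))) + (bWW + 4 * (n * 2))
      ≡⟨ cong (((bUU + (bUU' + bUW)) + ((bUU' + (bUU + bUW)) + (bUW + bUW))) +_) ∑-WW ⟩
    ((bUU + (bUU' + bUW)) + ((bUU' + (bUU + bUW)) + (bUW + bUW))) + 4 * (n * (2 * (n + arcSum n)))
      ≡⟨ block-polynomial n (arcSum n) ⟩
    2 * closedForm n (arcSum n) + 4 * (n * 2) ∎)
    where
    open ≡-Reasoning
    bUU bUU' bUW bWW : ℕ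
    bUU  = 2n * (9 * (n * n))
    bUU' = 9 * (2n * (2n + n * n) + n)
    bUW  = n * (6 * (2n + n * n))
    bWW  = ∑ (λ k → ∑ (λ l → 4 * wDist k l) 1 n) 1 n
    split : ∀ A B C M → ∑ (λ x → A x + (B x + C x)) 1 M ≡ ∑ A 1 M + (∑ B 1 M + ∑ C 1 M)
    split A B C M = trans (∑-distrib-+ A _ 1 M) (cong (∑ A 1 M +_) (∑-distrib-+ B C 1 M))
    blocks : ∑₃ (λ a → ∑₃ (term a)) ≡ (bUU + (bUU' + bUW)) + ((bUU' + (bUU + bUW)) + (bUW + (bUW + bWW)))
    blocks = cong₂ _+_
      (trans (split _ _ _ 2n) (cong₂ _+_ ∑-UU (cong₂ _+_ ∑-UU' ∑-UW)))
      (cong₂ _+_ (trans (split _ _ _ 2n) (cong₂ _+_ ∑-UU' (cong₂ _+_ ∑-UU ∑-UW)))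
                 (trans (split _ _ _ n) (cong₂ _+_ ∑-WU (cong (_+ bWW) ∑-WU))))
    regroup : ∀ a b c w e → ((a + (b + c)) + ((b + (a + c)) + (c + (c + w)))) + e
                          ≡ ((a + (b + c)) + ((b + (a + c)) + (c + c))) + (w + e)
    regroup = solve-∀

%2≡0⇒double : ∀ n → n % 2 ≡ 0 → n ≡ n / 2 + n / 2
%2≡0⇒double n n%2≡0 = trans (m≡m%n+[m/n]*n n 2)
  (trans (cong (_+ n / 2 * 2) n%2≡0) (trans (*-comm (n / 2) 2) (2*-double (n / 2))))

%2≡1⇒double+1 : ∀ n → n % 2 ≡ 1 → n ≡ suc (n / 2 + n / 2)
%2≡1⇒double+1 n n%2≡1 = trans (m≡m%n+[m/n]*n n 2)
  (trans (cong (_+ n / 2 * 2) n%2≡1) (cong suc (trans (*-comm (n / 2) 2) (2*-double (n / 2)))))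

closedForm-even : ∀ {n} r → n ≡ r + r → closedForm n (arcSum n) ≡ 49 * (n * n * n) + 64 * (n * n) + 5 * n
closedForm-even r refl rewrite arcSum-even r = polynomial r
  where
  polynomial : ∀ r →
    48 * ((r + r) * (r + r) * (r + r)) + 64 * ((r + r) * (r + r)) + 5 * (r + r) + (r + r) * (4 * (r * r))
    ≡ 49 * ((r + r) * (r + r) * (r + r)) + 64 * ((r + r) * (r + r)) + 5 * (r + r)
  polynomial = solve-∀

closedForm-odd : ∀ {n} r → n ≡ suc (r + r) → closedForm n (arcSum n) ≡ 49 * (n * n * n) + 64 * (n * n) + 4 * n
closedForm-odd r refl rewrite arcSum-odd r = polynomial r
  where
  polynomial : ∀ r →
    48 * (suc (r + r) * suc (r + r) * suc (r + r)) + 64 * (suc (r + r) * suc (r + r)) + 5 * suc (r + r)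
      + suc (r + r) * (4 * (r * suc r))
    ≡ 49 * (suc (r + r) * suc (r + r) * suc (r + r)) + 64 * (suc (r + r) * suc (r + r)) + 4 * suc (r + r)
  polynomial = solve-∀

theorem8 : (n : ℕ) → 2 ≤ n → (dist : V → V → ℕ) →
    (∀ a b → a ∈ vertices n → b ∈ vertices n → IsDist n a b (dist a b)) →
    (n % 2 ≡ 0 → Gut n dist ≡ 49 * (n * n * n) + 64 * (n * n) + 5 * n) ×
    (n % 2 ≡ 1 → Gut n dist ≡ 49 * (n * n * n) + 64 * (n * n) + 4 * n)
theorem8 n 2≤n dist isDist =
  (λ n%2≡0 → trans Gut≡closedForm (closedForm-even (n / 2) (%2≡0⇒double n n%2≡0))) ,
  (λ n%2≡1 → trans Gut≡closedForm (closedForm-odd (n / 2) (%2≡1⇒double+1 n n%2≡1)))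
  where
  open Pentagonal n 2≤n using (gutSum≡2*closedForm)
  Gut≡closedForm : Gut n dist ≡ closedForm n (arcSum n)
  Gut≡closedForm = trans (cong (_/ 2) (trans (gutSum≡2*closedForm dist isDist) (*-comm 2 c))) (m*n/n≡m c 2)
    where c = closedForm n (arcSum n)
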